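{- Let $\mathcal{M}$ be the set of Motzkin meanders that contain neither $DH$ nor $HU$ as a contiguous subword, and let $S(u)=\sum_{w\in\mathcal{M}} z^{|w|}u^{\mathrm{level}(w)}$. Put $$W=\sqrt{(1-3z+2z^2-z^3)(1+z-2z^2-z^3)},\qquad r_1=\frac{1-z-z^3-W}{2z(1-z)}.$$ Then $$S(u)=\frac{(1-z)r_1+z^2}{z(1-z)(1-ur_1)},$$ and for every $j\ge0$ the generating function of the meanders in $\mathcal{M}$ ending at level $j$ is $[u^j]S(u)=\frac{r_1^{j+1}}{z}+\frac{zr_1^{j}}{1-z}$.
   Context: A Motzkin meander is a finite word $w$ over $\{U,H,D\}$ (heights $+1,0,-1$) all of whose prefixes have nonnegative height sum; $|w|$ is its length and $\mathrm{level}(w)$ its total height sum; the empty word is included; excursions are meanders of level $0$. "Contains $XY$ as a contiguous subword" means two consecutive letters are $X$ then $Y$. Generating functions are formal power series in $z$; $W$ is the formal power series square root with constant term $1$; $[u^j]$ is coefficient extraction. -}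

module Defs where

open import Data.Bool using (Bool; true; false; _∧_; _∨_; not)
open import Data.Nat as ℕ using (ℕ; zero; suc; _∸_)
open import Data.Integer as ℤ using (ℤ; +_; _≤ᵇ_)
open import Data.Rational as ℚ using (ℚ; 0ℚ; 1ℚ; _/_)
open import Data.List using (List; []; _∷_; map; concatMap; filterᵇ; length)
open import Relation.Binary.PropositionalEquality using (_≡_)

data Step : Set where
  U H D : Step

stepHeight : Step → ℤ
stepHeight U = + 1
stepHeight H = + 0
stepHeight D = ℤ.- (+ 1)

height : List Step → ℤ
height [] = + 0
height (s ∷ w) = stepHeight s ℤ.+ height w

level : List Step → ℤ
level = height

prefixes : List Step → List (List Step)
prefixes [] = [] ∷ []
prefixes (s ∷ w) = [] ∷ map (s ∷_) (prefixes w)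

allᵇ : {A : Set} → (A → Bool) → List A → Bool
allᵇ p [] = true
allᵇ p (x ∷ xs) = p x ∧ allᵇ p xs

isMeander : List Step → Bool
isMeander w = allᵇ (λ p → + 0 ≤ᵇ height p) (prefixes w)

_==_ : Step → Step → Bool
U == U = true
H == H = true
D == D = true
_ == _ = false

containsAdj : Step → Step → List Step → Bool
containsAdj X Y [] = false
containsAdj X Y (a ∷ []) = false
containsAdj X Y (a ∷ b ∷ w) = ((a == X) ∧ (b == Y)) ∨ containsAdj X Y (b ∷ w)

inM : List Step → Bool
inM w = isMeander w ∧ not (containsAdj D H w) ∧ not (containsAdj H U w)

wordsOfLength : ℕ → List (List Step)
wordsOfLength zero = [] ∷ []
wordsOfLength (suc n) = concatMap (λ w → (U ∷ w) ∷ (H ∷ w) ∷ (D ∷ w) ∷ []) (wordsOfLength n)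

eqℤ : ℤ → ℤ → Bool
eqℤ a b = (a ≤ᵇ b) ∧ (b ≤ᵇ a)

countM : ℕ → ℕ → ℕ
countM n j = length (filterᵇ (λ w → inM w ∧ eqℤ (level w) (+ j)) (wordsOfLength n))

-- Formal power series over ℚ in z: f n = [z^n] f

PS : Set
PS = ℕ → ℚ

infixl 6 _+ₚ_ _-ₚ_ _-₂_
infixl 7 _*ₚ_ _*₂_
infixr 8 _^ₚ_
infix 4 _≈ₚ_ _≈₂_

_≈ₚ_ : PS → PS → Set
f ≈ₚ g = ∀ n → f n ≡ g n

sumTo : ℕ → (ℕ → ℚ) → ℚ
sumTo zero f = f 0
sumTo (suc n) f = sumTo n f ℚ.+ f (suc n)

_+ₚ_ : PS → PS → PS
(f +ₚ g) n = f n ℚ.+ g n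

_-ₚ_ : PS → PS → PS
(f -ₚ g) n = f n ℚ.- g n

_*ₚ_ : PS → PS → PS
(f *ₚ g) n = sumTo n (λ i → f i ℚ.* g (n ∸ i))

_^ₚ_ : PS → ℕ → PS
f ^ₚ zero = λ { zero → 1ℚ ; (suc _) → 0ℚ }
f ^ₚ suc k = f *ₚ (f ^ₚ k)

const : ℚ → PS
const c zero = c
const c (suc _) = 0ℚ

oneₚ : PS
oneₚ = const 1ℚ

zₚ : PS
zₚ (suc zero) = 1ℚ
zₚ _ = 0ℚ

-- f / z  (division by z; it is the formal quotient when f 0 = 0)
divZ : PS → PS
divZ f n = f (suc n)

-- 1/(1-z) = Σ z^n
invOneMinusZ : PS
invOneMinusZ _ = 1ℚ

ℚof : ℕ → ℚ
ℚof n = + n / 1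

-- Bivariate series in z,u: F n j = [z^n u^j] F

PS2 : Set
PS2 = ℕ → ℕ → ℚ

_≈₂_ : PS2 → PS2 → Set
F ≈₂ G = ∀ n j → F n j ≡ G n j

_*₂_ : PS2 → PS2 → PS2
(F *₂ G) n j = sumTo n (λ a → sumTo j (λ b → F a b ℚ.* G (n ∸ a) (j ∸ b)))

lift : PS → PS2
lift f n zero = f n
lift f n (suc _) = 0ℚ

uₚ : PS2
uₚ zero (suc zero) = 1ℚ
uₚ _ _ = 0ℚ

_-₂_ : PS2 → PS2 → PS2
(F -₂ G) n j = F n j ℚ.- G n j

Sgf : PS2
Sgf n j = ℚof (countM n j)

Scoeff : ℕ → PS
Scoeff j n = Sgf n j

radicand : PS
radicand = (oneₚ -ₚ (const (ℚof 3) *ₚ zₚ) +ₚ (const (ℚof 2) *ₚ (zₚ ^ₚ 2)) -ₚ (zₚ ^ₚ 3))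
        *ₚ (oneₚ +ₚ zₚ -ₚ (const (ℚof 2) *ₚ (zₚ ^ₚ 2)) -ₚ (zₚ ^ₚ 3))

{-# OPTIONS --safe #-}

-- Read a word from left to right by an automaton whose state is the current level and the last
-- letter; a forbidden factor DH or HU, or a step below level 0, leads to a dead state. Let u_j,
-- h_j, d_j be the generating functions of the words of M that end at level j with last letter
-- U, H, D. Appending one letter gives the system
--   u₀ = 1,  u_{j+1} = z(u_j + d_j),  h_j = z(u_j + h_j),  d_j = z(u_{j+1} + h_{j+1} + d_{j+1}),
-- which determines all coefficients by induction on the length. The hypotheses make r = r₁ the
-- power-series root of the kernel z(1-z)r² - (1-z-z³)r + z(1-z), so r = zs with s(0) = 1 and
-- s - 1 = z²s(s + z/(1-z)); with this, u_j = r^j, h_j = z r^j/(1-z), d_j = (s-1) r^j solve the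
-- system. Hence [u^j]S = (s + z/(1-z)) r^j, which gives both claimed formulas.

module Submission where

open import Defs
open import Data.Nat using (ℕ; suc)
open import Data.Rational using (1ℚ)
open import Data.Product using (_×_)
open import Relation.Binary.PropositionalEquality using (_≡_)

open import Data.Nat as ℕ using (zero; _∸_; _≡ᵇ_) renaming (_+_ to _ℕ+_)
import Data.Nat.Properties as ℕ
import Data.Nat.Coprimality as Coprimality
open import Data.Integer as ℤ using (ℤ; +_; -[1+_])
import Data.Integer.Properties as ℤ
open import Data.Rational as ℚ using (ℚ; 0ℚ)
import Data.Rational.Properties as ℚ
open import Data.Rational.Solver using (module +-*-Solver)
open import Data.Bool using (Bool; true; false; _∧_; not)
import Data.Bool.Properties as Bool
open import Data.List using (List; []; _∷_; _++_; _∷ʳ_; foldl; map; concatMap; filterᵇ; length)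
import Data.List.Properties as List
open import Data.Product using (_,_; proj₁; proj₂)
open import Data.Maybe using (Maybe; just; nothing)
open import Relation.Nullary using (yes; no)
open import Relation.Binary.PropositionalEquality
  using (refl; sym; trans; cong; cong₂; module ≡-Reasoning)
open import Algebra.Bundles using (CommutativeRing; CommutativeMonoid)
open import Algebra.Structures using (IsCommutativeRing)
import Algebra.Construct.Pointwise as Pointwise
open import Algebra.Properties.CommutativeSemigroup
  (CommutativeMonoid.commutativeSemigroup ℚ.+-0-commutativeMonoid)
  using (x∙yz≈y∙xz) renaming (interchange to ℚ-+-interchange)
open import Algebra.Properties.CommutativeSemigroup ℕ.+-commutativeSemigroup
  using () renaming (interchange to ℕ-+-interchange)
open import Algebra.Properties.Group ℚ.+-0-group using (x∙y⁻¹≈ε⇒x≈y)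
open import Algebra.Solver.Ring.AlmostCommutativeRing
  using (fromCommutativeRing; _-Raw-AlmostCommutative⟶_)
import Algebra.Solver.Ring
import Relation.Binary.Reasoning.Setoid

-- Power series over ℚ

sumTo-cong : ∀ n {f g : ℕ → ℚ} → (∀ i → f i ≡ g i) → sumTo n f ≡ sumTo n g
sumTo-cong zero    f≗g = f≗g 0
sumTo-cong (suc n) f≗g = cong₂ ℚ._+_ (sumTo-cong n f≗g) (f≗g (suc n))

sumTo-+ : ∀ n (f g : ℕ → ℚ) → sumTo n (λ i → f i ℚ.+ g i) ≡ sumTo n f ℚ.+ sumTo n g
sumTo-+ zero    f g = refl
sumTo-+ (suc n) f g = trans (cong (ℚ._+ (f (suc n) ℚ.+ g (suc n))) (sumTo-+ n f g))
  (ℚ-+-interchange (sumTo n f) (sumTo n g) (f (suc n)) (g (suc n)))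

sumTo-*ˡ : ∀ n c (f : ℕ → ℚ) → sumTo n (λ i → c ℚ.* f i) ≡ c ℚ.* sumTo n f
sumTo-*ˡ zero    c f = refl
sumTo-*ˡ (suc n) c f = trans (cong (ℚ._+ (c ℚ.* f (suc n))) (sumTo-*ˡ n c f))
  (sym (ℚ.*-distribˡ-+ c (sumTo n f) (f (suc n))))

sumTo-zero : ∀ n {f : ℕ → ℚ} → (∀ i → f i ≡ 0ℚ) → sumTo n f ≡ 0ℚ
sumTo-zero zero    f≗0 = f≗0 0
sumTo-zero (suc n) f≗0 = cong₂ ℚ._+_ (sumTo-zero n f≗0) (f≗0 (suc n))

sumTo-unfoldˡ : ∀ n (f : ℕ → ℚ) → sumTo (suc n) f ≡ f 0 ℚ.+ sumTo n (λ i → f (suc i))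
sumTo-unfoldˡ zero    f = refl
sumTo-unfoldˡ (suc n) f = trans (cong (ℚ._+ f (suc (suc n))) (sumTo-unfoldˡ n f))
  (ℚ.+-assoc (f 0) _ _)

sumTo-head : ∀ n (f : ℕ → ℚ) → (∀ i → f (suc i) ≡ 0ℚ) → sumTo n f ≡ f 0
sumTo-head zero    f tail≗0 = refl
sumTo-head (suc n) f tail≗0 = begin
  sumTo (suc n) f                     ≡⟨ sumTo-unfoldˡ n f ⟩
  f 0 ℚ.+ sumTo n (λ i → f (suc i))   ≡⟨ cong (f 0 ℚ.+_) (sumTo-zero n tail≗0) ⟩
  f 0 ℚ.+ 0ℚ                          ≡⟨ ℚ.+-identityʳ (f 0) ⟩
  f 0                                 ∎
  where open ≡-Reasoning

0ₚ : PS
0ₚ _ = 0ℚ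

-ₚ_ : PS → PS
(-ₚ f) n = ℚ.- f n

*ₚ-cong : ∀ {f f′ g g′} → f ≈ₚ f′ → g ≈ₚ g′ → f *ₚ g ≈ₚ f′ *ₚ g′
*ₚ-cong f≈f′ g≈g′ n = sumTo-cong n (λ i → cong₂ ℚ._*_ (f≈f′ i) (g≈g′ (n ∸ i)))

-ₚ-cong : ∀ {f f′ g g′} → f ≈ₚ f′ → g ≈ₚ g′ → f -ₚ g ≈ₚ f′ -ₚ g′
-ₚ-cong f≈f′ g≈g′ n = cong₂ ℚ._-_ (f≈f′ n) (g≈g′ n)

*ₚ-suc : ∀ f g n → (f *ₚ g) (suc n) ≡ f 0 ℚ.* g (suc n) ℚ.+ (divZ f *ₚ g) n
*ₚ-suc f g n = sumTo-unfoldˡ n (λ i → f i ℚ.* g (suc n ∸ i))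

*ₚ-zeroˡ : ∀ f → 0ₚ *ₚ f ≈ₚ 0ₚ
*ₚ-zeroˡ f n = sumTo-zero n (λ i → ℚ.*-zeroˡ (f (n ∸ i)))

*ₚ-identityˡ : ∀ f → oneₚ *ₚ f ≈ₚ f
*ₚ-identityˡ f zero    = ℚ.*-identityˡ (f 0)
*ₚ-identityˡ f (suc n) = begin
  (oneₚ *ₚ f) (suc n)                    ≡⟨ *ₚ-suc oneₚ f n ⟩
  1ℚ ℚ.* f (suc n) ℚ.+ (0ₚ *ₚ f) n
    ≡⟨ cong₂ ℚ._+_ (ℚ.*-identityˡ (f (suc n))) (*ₚ-zeroˡ f n) ⟩
  f (suc n) ℚ.+ 0ℚ                       ≡⟨ ℚ.+-identityʳ (f (suc n)) ⟩
  f (suc n)                              ∎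
  where open ≡-Reasoning

*ₚ-distribʳ : ∀ h f g → (f +ₚ g) *ₚ h ≈ₚ f *ₚ h +ₚ g *ₚ h
*ₚ-distribʳ h f g n = trans (sumTo-cong n (λ i → ℚ.*-distribʳ-+ (h (n ∸ i)) (f i) (g i)))
  (sumTo-+ n (λ i → f i ℚ.* h (n ∸ i)) (λ i → g i ℚ.* h (n ∸ i)))

*ₚ-assoc-const : ∀ c f g → ((λ n → c ℚ.* f n) *ₚ g) ≈ₚ (λ n → c ℚ.* (f *ₚ g) n)
*ₚ-assoc-const c f g n = trans (sumTo-cong n (λ i → ℚ.*-assoc c (f i) (g (n ∸ i))))
  (sumTo-*ˡ n c (λ i → f i ℚ.* g (n ∸ i)))

*ₚ-comm : ∀ f g → f *ₚ g ≈ₚ g *ₚ f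
*ₚ-comm f g zero    = ℚ.*-comm (f 0) (g 0)
*ₚ-comm f g (suc n) = begin
  (f *ₚ g) (suc n)                       ≡⟨ *ₚ-suc f g n ⟩
  f 0 ℚ.* g (suc n) ℚ.+ (divZ f *ₚ g) n  ≡⟨ cong (f 0 ℚ.* g (suc n) ℚ.+_) (*ₚ-comm (divZ f) g n) ⟩
  f 0 ℚ.* g (suc n) ℚ.+ (g *ₚ divZ f) n  ≡⟨ swap-heads n ⟩
  g 0 ℚ.* f (suc n) ℚ.+ (f *ₚ divZ g) n  ≡⟨ cong (g 0 ℚ.* f (suc n) ℚ.+_) (*ₚ-comm f (divZ g) n) ⟩
  g 0 ℚ.* f (suc n) ℚ.+ (divZ g *ₚ f) n  ≡⟨ *ₚ-suc g f n ⟨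
  (g *ₚ f) (suc n)                       ∎
  where
  open ≡-Reasoning
  swap-heads : ∀ m → f 0 ℚ.* g (suc m) ℚ.+ (g *ₚ divZ f) m ≡ g 0 ℚ.* f (suc m) ℚ.+ (f *ₚ divZ g) m
  swap-heads zero    = ℚ.+-comm (f 0 ℚ.* g 1) (g 0 ℚ.* f 1)
  swap-heads (suc m) = begin
    f 0 ℚ.* g (2 ℕ+ m) ℚ.+ (g *ₚ divZ f) (suc m)
      ≡⟨ cong (f 0 ℚ.* g (2 ℕ+ m) ℚ.+_) (*ₚ-suc g (divZ f) m) ⟩
    f 0 ℚ.* g (2 ℕ+ m) ℚ.+ (g 0 ℚ.* f (2 ℕ+ m) ℚ.+ (divZ g *ₚ divZ f) m)
      ≡⟨ cong (λ x → f 0 ℚ.* g (2 ℕ+ m) ℚ.+ (g 0 ℚ.* f (2 ℕ+ m) ℚ.+ x))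
           (*ₚ-comm (divZ g) (divZ f) m) ⟩
    f 0 ℚ.* g (2 ℕ+ m) ℚ.+ (g 0 ℚ.* f (2 ℕ+ m) ℚ.+ (divZ f *ₚ divZ g) m)
      ≡⟨ x∙yz≈y∙xz (f 0 ℚ.* g (2 ℕ+ m)) (g 0 ℚ.* f (2 ℕ+ m)) ((divZ f *ₚ divZ g) m) ⟩
    g 0 ℚ.* f (2 ℕ+ m) ℚ.+ (f 0 ℚ.* g (2 ℕ+ m) ℚ.+ (divZ f *ₚ divZ g) m)
      ≡⟨ cong (g 0 ℚ.* f (2 ℕ+ m) ℚ.+_) (*ₚ-suc f (divZ g) m) ⟨
    g 0 ℚ.* f (2 ℕ+ m) ℚ.+ (f *ₚ divZ g) (suc m) ∎

*ₚ-assoc : ∀ f g h → (f *ₚ g) *ₚ h ≈ₚ f *ₚ (g *ₚ h)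
*ₚ-assoc f g h zero    = ℚ.*-assoc (f 0) (g 0) (h 0)
*ₚ-assoc f g h (suc n) = begin
  ((f *ₚ g) *ₚ h) (suc n)
    ≡⟨ *ₚ-suc (f *ₚ g) h n ⟩
  (f 0 ℚ.* g 0) ℚ.* h (suc n) ℚ.+ (divZ (f *ₚ g) *ₚ h) n
    ≡⟨ cong ((f 0 ℚ.* g 0) ℚ.* h (suc n) ℚ.+_) shifted ⟩
  (f 0 ℚ.* g 0) ℚ.* h (suc n) ℚ.+ (f 0 ℚ.* (divZ g *ₚ h) n ℚ.+ (divZ f *ₚ (g *ₚ h)) n)
    ≡⟨ solve 5 (λ a b c d e → (a :* b) :* c :+ (a :* d :+ e) := a :* (b :* c :+ d) :+ e) refl
         (f 0) (g 0) (h (suc n)) ((divZ g *ₚ h) n) ((divZ f *ₚ (g *ₚ h)) n) ⟩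
  f 0 ℚ.* (g 0 ℚ.* h (suc n) ℚ.+ (divZ g *ₚ h) n) ℚ.+ (divZ f *ₚ (g *ₚ h)) n
    ≡⟨ cong (λ x → f 0 ℚ.* x ℚ.+ (divZ f *ₚ (g *ₚ h)) n) (*ₚ-suc g h n) ⟨
  f 0 ℚ.* (g *ₚ h) (suc n) ℚ.+ (divZ f *ₚ (g *ₚ h)) n
    ≡⟨ *ₚ-suc f (g *ₚ h) n ⟨
  (f *ₚ (g *ₚ h)) (suc n) ∎
  where
  open ≡-Reasoning
  open +-*-Solver
  shifted : (divZ (f *ₚ g) *ₚ h) n ≡ f 0 ℚ.* (divZ g *ₚ h) n ℚ.+ (divZ f *ₚ (g *ₚ h)) n
  shifted = begin
    (divZ (f *ₚ g) *ₚ h) n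
      ≡⟨ *ₚ-cong {g = h} (*ₚ-suc f g) (λ _ → refl) n ⟩
    (((λ m → f 0 ℚ.* divZ g m) +ₚ divZ f *ₚ g) *ₚ h) n
      ≡⟨ *ₚ-distribʳ h (λ m → f 0 ℚ.* divZ g m) (divZ f *ₚ g) n ⟩
    ((λ m → f 0 ℚ.* divZ g m) *ₚ h) n ℚ.+ ((divZ f *ₚ g) *ₚ h) n
      ≡⟨ cong₂ ℚ._+_ (*ₚ-assoc-const (f 0) (divZ g) h n) (*ₚ-assoc (divZ f) g h n) ⟩
    f 0 ℚ.* (divZ g *ₚ h) n ℚ.+ (divZ f *ₚ (g *ₚ h)) n ∎

*ₚ-identityʳ : ∀ f → f *ₚ oneₚ ≈ₚ f
*ₚ-identityʳ f n = trans (*ₚ-comm f oneₚ n) (*ₚ-identityˡ f n)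

*ₚ-distribˡ : ∀ h f g → h *ₚ (f +ₚ g) ≈ₚ h *ₚ f +ₚ h *ₚ g
*ₚ-distribˡ h f g n = trans (*ₚ-comm h (f +ₚ g) n) (trans (*ₚ-distribʳ h f g n)
  (cong₂ ℚ._+_ (*ₚ-comm f h n) (*ₚ-comm g h n)))

PS-isCommutativeRing : IsCommutativeRing _≈ₚ_ _+ₚ_ _*ₚ_ -ₚ_ 0ₚ oneₚ
PS-isCommutativeRing = record
  { isRing = record
    { +-isAbelianGroup = Pointwise.isAbelianGroup ℕ ℚ.+-0-isAbelianGroup
    ; *-cong           = *ₚ-cong
    ; *-assoc          = *ₚ-assoc
    ; *-identity       = *ₚ-identityˡ , *ₚ-identityʳ
    ; distrib          = *ₚ-distribˡ , *ₚ-distribʳ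
    }
  ; *-comm = *ₚ-comm
  }

PS-commutativeRing : CommutativeRing _ _
PS-commutativeRing = record { isCommutativeRing = PS-isCommutativeRing }

const-homomorphism : ℚ.+-*-rawRing -Raw-AlmostCommutative⟶ fromCommutativeRing PS-commutativeRing
const-homomorphism = record
  { ⟦_⟧    = const
  ; +-homo = λ { a b zero → refl ; a b (suc n) → refl }
  ; *-homo = λ { a b zero → refl ; a b (suc n) → sym (const-*-suc a b n) }
  ; -‿homo = λ { a zero → refl ; a (suc n) → refl }
  ; 0-homo = λ { zero → refl ; (suc n) → refl }
  ; 1-homo = λ _ → refl
  }
  where
  const-*-suc : ∀ a b n → (const a *ₚ const b) (suc n) ≡ 0ℚ
  const-*-suc a b n = trans (*ₚ-suc (const a) (const b) n)
    (cong₂ ℚ._+_ (ℚ.*-zeroʳ a) (sumTo-zero n (λ i → ℚ.*-zeroˡ (const b (n ∸ i)))))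

const-≟ : ∀ a b → Maybe (const a ≈ₚ const b)
const-≟ a b with a ℚ.≟ b
... | yes refl = just (λ _ → refl)
... | no _     = nothing

module PS-Solver = Algebra.Solver.Ring ℚ.+-*-rawRing (fromCommutativeRing PS-commutativeRing)
  const-homomorphism const-≟

module PS = CommutativeRing PS-commutativeRing
open import Algebra.Properties.Semiring.Exp PS.semiring using (_^_)
module ≈-Reasoning = Relation.Binary.Reasoning.Setoid PS.setoid

^ₚ≈^ : ∀ f k → f ^ₚ k ≈ₚ f ^ k
^ₚ≈^ f zero    zero    = refl
^ₚ≈^ f zero    (suc n) = refl
^ₚ≈^ f (suc k)         = *ₚ-cong {f} (λ _ → refl) (^ₚ≈^ f k)

zₚ-*ₚ-suc : ∀ f n → (zₚ *ₚ f) (suc n) ≡ f n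
zₚ-*ₚ-suc f n = begin
  (zₚ *ₚ f) (suc n)                         ≡⟨ *ₚ-suc zₚ f n ⟩
  0ℚ ℚ.* f (suc n) ℚ.+ (divZ zₚ *ₚ f) n
    ≡⟨ cong₂ ℚ._+_ (ℚ.*-zeroˡ (f (suc n))) (*ₚ-cong {g = f} divZ-zₚ (λ _ → refl) n) ⟩
  0ℚ ℚ.+ (oneₚ *ₚ f) n                      ≡⟨ ℚ.+-identityˡ _ ⟩
  (oneₚ *ₚ f) n                             ≡⟨ *ₚ-identityˡ f n ⟩
  f n                                       ∎
  where
  open ≡-Reasoning
  divZ-zₚ : divZ zₚ ≈ₚ oneₚ
  divZ-zₚ zero    = refl
  divZ-zₚ (suc n) = refl

zₚ-*ₚ-cancelˡ : ∀ {f g} → zₚ *ₚ f ≈ₚ zₚ *ₚ g → f ≈ₚ g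
zₚ-*ₚ-cancelˡ {f} {g} zf≈zg n = trans (sym (zₚ-*ₚ-suc f n)) (trans (zf≈zg (suc n)) (zₚ-*ₚ-suc g n))

*ₚ-cancelˡ-invertible : ∀ {u v f g} → v *ₚ u ≈ₚ oneₚ → u *ₚ f ≈ₚ u *ₚ g → f ≈ₚ g
*ₚ-cancelˡ-invertible {u} {v} {f} {g} vu≈1 uf≈ug = begin
  f                ≈⟨ PS.sym (*ₚ-identityˡ f) ⟩
  oneₚ *ₚ f        ≈⟨ *ₚ-cong (PS.sym vu≈1) (PS.refl {f}) ⟩
  (v *ₚ u) *ₚ f    ≈⟨ *ₚ-assoc v u f ⟩
  v *ₚ (u *ₚ f)    ≈⟨ *ₚ-cong (PS.refl {v}) uf≈ug ⟩
  v *ₚ (u *ₚ g)    ≈⟨ *ₚ-assoc v u g ⟨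
  (v *ₚ u) *ₚ g    ≈⟨ *ₚ-cong vu≈1 (PS.refl {g}) ⟩
  oneₚ *ₚ g        ≈⟨ *ₚ-identityˡ g ⟩
  g                ∎
  where open ≈-Reasoning

invOneMinusZ-inverse : invOneMinusZ *ₚ (oneₚ -ₚ zₚ) ≈ₚ oneₚ
invOneMinusZ-inverse zero    = refl
invOneMinusZ-inverse (suc n) = trans (*ₚ-comm invOneMinusZ (oneₚ -ₚ zₚ) (suc n))
  (trans (*ₚ-suc (oneₚ -ₚ zₚ) invOneMinusZ n)
    (cong (1ℚ ℚ.+_) (sumTo-head n _ (λ i → ℚ.*-zeroˡ 1ℚ))))

zₚ-*ₚ-zero : ∀ f → (zₚ *ₚ f) 0 ≡ 0ℚ
zₚ-*ₚ-zero f = ℚ.*-zeroˡ (f 0)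

≈zₚ-*ₚ : ∀ {f g} → f 0 ≡ 0ℚ → (∀ n → f (suc n) ≡ g n) → f ≈ₚ zₚ *ₚ g
≈zₚ-*ₚ {g = g} f₀≡0 f≗g zero    = trans f₀≡0 (sym (zₚ-*ₚ-zero g))
≈zₚ-*ₚ {g = g} f₀≡0 f≗g (suc n) = trans (f≗g n) (sym (zₚ-*ₚ-suc g n))

divZ-*ₚ : ∀ {f} g → f 0 ≡ 0ℚ → divZ (f *ₚ g) ≈ₚ divZ f *ₚ g
divZ-*ₚ {f} g f₀≡0 n = trans (*ₚ-suc f g n)
  (trans (cong (ℚ._+ (divZ f *ₚ g) n) (trans (cong (ℚ._* g (suc n)) f₀≡0) (ℚ.*-zeroˡ (g (suc n)))))
    (ℚ.+-identityˡ _))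

invOneMinusZ-unfold : invOneMinusZ ≈ₚ oneₚ +ₚ zₚ *ₚ invOneMinusZ
invOneMinusZ-unfold zero    = refl
invOneMinusZ-unfold (suc n) = sym (trans (ℚ.+-identityˡ _) (zₚ-*ₚ-suc invOneMinusZ n))

coeff-zero : ∀ {f} g → f ≈ₚ zₚ *ₚ g → f 0 ≡ 0ℚ
coeff-zero g f≈zg = trans (f≈zg 0) (zₚ-*ₚ-zero g)

coeff-suc : ∀ {f} g → f ≈ₚ zₚ *ₚ g → ∀ n → f (suc n) ≡ g n
coeff-suc g f≈zg n = trans (f≈zg (suc n)) (zₚ-*ₚ-suc g n)

-- Bivariate series by columns

column : PS2 → ℕ → PS
column F j n = F n j

column-lift-*₂ : ∀ f F j → column (lift f *₂ F) j ≈ₚ f *ₚ column F j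
column-lift-*₂ f F j n = sumTo-cong n (λ a →
  sumTo-head j (λ b → lift f a b ℚ.* F (n ∸ a) (j ∸ b)) (λ b → ℚ.*-zeroˡ (F (n ∸ a) (j ∸ suc b))))

column-uₚ-*₂-zero : ∀ F → column (uₚ *₂ F) 0 ≈ₚ 0ₚ
column-uₚ-*₂-zero F n =
  sumTo-zero n (λ a → trans (cong (ℚ._* F (n ∸ a) 0) (uₚ-at-0 a)) (ℚ.*-zeroˡ (F (n ∸ a) 0)))
  where
  uₚ-at-0 : ∀ a → uₚ a 0 ≡ 0ℚ
  uₚ-at-0 zero    = refl
  uₚ-at-0 (suc a) = refl

column-uₚ-*₂-suc : ∀ F j → column (uₚ *₂ F) (suc j) ≈ₚ column F j
column-uₚ-*₂-suc F j n = begin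
  sumTo n (λ a → sumTo (suc j) (λ b → uₚ a b ℚ.* F (n ∸ a) (suc j ∸ b)))
    ≡⟨ sumTo-head n _ (λ a → sumTo-zero (suc j) (λ b → ℚ.*-zeroˡ (F (n ∸ suc a) (suc j ∸ b)))) ⟩
  sumTo (suc j) (λ b → uₚ 0 b ℚ.* F n (suc j ∸ b))
    ≡⟨ sumTo-unfoldˡ j (λ b → uₚ 0 b ℚ.* F n (suc j ∸ b)) ⟩
  0ℚ ℚ.* F n (suc j) ℚ.+ sumTo j (λ b → uₚ 0 (suc b) ℚ.* F n (j ∸ b))
    ≡⟨ cong₂ ℚ._+_ (ℚ.*-zeroˡ (F n (suc j))) (sumTo-head j _ (λ b → ℚ.*-zeroˡ (F n (j ∸ suc b)))) ⟩
  0ℚ ℚ.+ 1ℚ ℚ.* F n j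
    ≡⟨ trans (ℚ.+-identityˡ _) (ℚ.*-identityˡ (F n j)) ⟩
  F n j ∎
  where open ≡-Reasoning

column-*₂-suc : ∀ M F → (∀ n j → M n (suc (suc j)) ≡ 0ℚ)
  → ∀ k → column (M *₂ F) (suc k) ≈ₚ column M 0 *ₚ column F (suc k) +ₚ column M 1 *ₚ column F k
column-*₂-suc M F M-linear k n = trans (sumTo-cong n inner)
  (sumTo-+ n (λ a → M a 0 ℚ.* F (n ∸ a) (suc k)) (λ a → M a 1 ℚ.* F (n ∸ a) k))
  where
  inner : ∀ a → sumTo (suc k) (λ b → M a b ℚ.* F (n ∸ a) (suc k ∸ b))
              ≡ M a 0 ℚ.* F (n ∸ a) (suc k) ℚ.+ M a 1 ℚ.* F (n ∸ a) k
  inner a = trans (sumTo-unfoldˡ k (λ b → M a b ℚ.* F (n ∸ a) (suc k ∸ b)))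
    (cong (M a 0 ℚ.* F (n ∸ a) (suc k) ℚ.+_) (sumTo-head k _ (λ b →
      trans (cong (ℚ._* F (n ∸ a) (k ∸ suc b)) (M-linear a b)) (ℚ.*-zeroˡ (F (n ∸ a) (k ∸ suc b))))))

linearInU : PS → PS → PS2
linearInU p g = lift p *₂ (lift oneₚ -₂ uₚ *₂ lift g)

linearInU-column-0 : ∀ p g → column (linearInU p g) 0 ≈ₚ p
linearInU-column-0 p g = PS.trans (column-lift-*₂ p (lift oneₚ -₂ uₚ *₂ lift g) 0)
  (PS.trans (*ₚ-cong (PS.refl {p}) one-minus-0) (*ₚ-identityʳ p))
  where
  one-minus-0 : ∀ n → oneₚ n ℚ.- (uₚ *₂ lift g) n 0 ≡ oneₚ n
  one-minus-0 n =
    trans (cong (λ x → oneₚ n ℚ.- x) (column-uₚ-*₂-zero (lift g) n)) (ℚ.+-identityʳ (oneₚ n))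

linearInU-column-1 : ∀ p g → column (linearInU p g) 1 ≈ₚ p *ₚ (-ₚ g)
linearInU-column-1 p g =
  PS.trans (column-lift-*₂ p (lift oneₚ -₂ uₚ *₂ lift g) 1) (*ₚ-cong (PS.refl {p}) zero-minus)
  where
  zero-minus : ∀ n → 0ℚ ℚ.- (uₚ *₂ lift g) n 1 ≡ ℚ.- g n
  zero-minus n =
    trans (cong (λ x → 0ℚ ℚ.- x) (column-uₚ-*₂-suc (lift g) 0 n)) (ℚ.+-identityˡ (ℚ.- g n))

linearInU-degree≤1 : ∀ p g n j → linearInU p g n (suc (suc j)) ≡ 0ℚ
linearInU-degree≤1 p g n j = trans (column-lift-*₂ p (lift oneₚ -₂ uₚ *₂ lift g) (suc (suc j)) n)
  (trans (*ₚ-cong (PS.refl {p}) vanishes n) (PS.zeroʳ p n))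
  where
  vanishes : ∀ m → 0ℚ ℚ.- (uₚ *₂ lift g) m (suc (suc j)) ≡ 0ℚ
  vanishes m = cong (λ x → 0ℚ ℚ.- x) (column-uₚ-*₂-suc (lift g) (suc j) m)

-- Satisfied by the generating functions u j, h j, d j of the words of M ending at level j with
-- last letter U, H, D (the empty word counting as ending with U).
record LastLetterSystem (u h d : ℕ → PS) : Set where
  field
    u-zero : u 0 ≈ₚ oneₚ
    u-suc  : ∀ j → u (suc j) ≈ₚ zₚ *ₚ (u j +ₚ d j)
    h-rec  : ∀ j → h j ≈ₚ zₚ *ₚ (u j +ₚ h j)
    d-rec  : ∀ j → d j ≈ₚ zₚ *ₚ (u (suc j) +ₚ h (suc j) +ₚ d (suc j))

  u-suc-at-0 : ∀ j → u (suc j) 0 ≡ 0ℚ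
  u-suc-at-0 j = coeff-zero (u j +ₚ d j) (u-suc j)

  h-at-0 : ∀ j → h j 0 ≡ 0ℚ
  h-at-0 j = coeff-zero (u j +ₚ h j) (h-rec j)

  d-at-0 : ∀ j → d j 0 ≡ 0ℚ
  d-at-0 j = coeff-zero (u (suc j) +ₚ h (suc j) +ₚ d (suc j)) (d-rec j)

  u-at-suc : ∀ j n → u (suc j) (suc n) ≡ u j n ℚ.+ d j n
  u-at-suc j = coeff-suc (u j +ₚ d j) (u-suc j)

  h-at-suc : ∀ j n → h j (suc n) ≡ u j n ℚ.+ h j n
  h-at-suc j = coeff-suc (u j +ₚ h j) (h-rec j)

  d-at-suc : ∀ j n → d j (suc n) ≡ u (suc j) n ℚ.+ h (suc j) n ℚ.+ d (suc j) n
  d-at-suc j = coeff-suc (u (suc j) +ₚ h (suc j) +ₚ d (suc j)) (d-rec j)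

LastLetterSystem-unique : ∀ {u h d u′ h′ d′} → LastLetterSystem u h d → LastLetterSystem u′ h′ d′
  → ∀ n j → u j n ≡ u′ j n × h j n ≡ h′ j n × d j n ≡ d′ j n
LastLetterSystem-unique {u} {h} {d} {u′} {h′} {d′} S S′ = agree
  where
  module S = LastLetterSystem S
  module S′ = LastLetterSystem S′
  agree : ∀ n j → u j n ≡ u′ j n × h j n ≡ h′ j n × d j n ≡ d′ j n
  h-d-agree : ∀ n j → h j (suc n) ≡ h′ j (suc n) × d j (suc n) ≡ d′ j (suc n)
  u-agree : ∀ n j → u j n ≡ u′ j n
  u-agree n       zero    = trans (S.u-zero n) (sym (S′.u-zero n))
  u-agree zero    (suc j) = trans (S.u-suc-at-0 j) (sym (S′.u-suc-at-0 j))
  u-agree (suc n) (suc j) with agree n j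
  ... | u≡ , _ , d≡ = trans (S.u-at-suc j n) (trans (cong₂ ℚ._+_ u≡ d≡) (sym (S′.u-at-suc j n)))
  agree zero j = u-agree zero j
               , trans (S.h-at-0 j) (sym (S′.h-at-0 j))
               , trans (S.d-at-0 j) (sym (S′.d-at-0 j))
  agree (suc n) j = u-agree (suc n) j , h-d-agree n j
  h-d-agree n j with agree n j | agree n (suc j)
  ... | u≡ , h≡ , _ | u₊≡ , h₊≡ , d₊≡ =
      trans (S.h-at-suc j n) (trans (cong₂ ℚ._+_ u≡ h≡) (sym (S′.h-at-suc j n)))
    , trans (S.d-at-suc j n) (trans (cong₂ ℚ._+_ (cong₂ ℚ._+_ u₊≡ h₊≡) d₊≡) (sym (S′.d-at-suc j n)))

-- Counting words of M by last letter and final level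

sumList : {A : Set} → List A → (A → ℕ) → ℕ
sumList []       f = 0
sumList (x ∷ xs) f = f x ℕ+ sumList xs f

sumList-cong : ∀ {A : Set} (xs : List A) {f g} → (∀ x → f x ≡ g x) → sumList xs f ≡ sumList xs g
sumList-cong []       f≗g = refl
sumList-cong (x ∷ xs) f≗g = cong₂ _ℕ+_ (f≗g x) (sumList-cong xs f≗g)

sumList-++ : ∀ {A : Set} (xs ys : List A) f → sumList (xs ++ ys) f ≡ sumList xs f ℕ+ sumList ys f
sumList-++ []       ys f = refl
sumList-++ (x ∷ xs) ys f = trans (cong (f x ℕ+_) (sumList-++ xs ys f)) (sym (ℕ.+-assoc (f x) _ _))

sumList-concatMap : ∀ {A B : Set} (g : A → List B) xs f
  → sumList (concatMap g xs) f ≡ sumList xs (λ x → sumList (g x) f)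
sumList-concatMap g []       f = refl
sumList-concatMap g (x ∷ xs) f = trans (sumList-++ (g x) (concatMap g xs) f)
  (cong (sumList (g x) f ℕ+_) (sumList-concatMap g xs f))

sumList-zero : ∀ {A : Set} (xs : List A) → sumList xs (λ _ → 0) ≡ 0
sumList-zero []       = refl
sumList-zero (x ∷ xs) = sumList-zero xs

sumList-+ : ∀ {A : Set} (xs : List A) f g → sumList xs (λ x → f x ℕ+ g x) ≡ sumList xs f ℕ+ sumList xs g
sumList-+ []       f g = refl
sumList-+ (x ∷ xs) f g = trans (cong (f x ℕ+ g x ℕ+_) (sumList-+ xs f g))
  (ℕ-+-interchange (f x) (g x) (sumList xs f) (sumList xs g))

sumList-comm : ∀ {A B : Set} (xs : List A) (ys : List B) (f : A → B → ℕ)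
  → sumList xs (λ x → sumList ys (f x)) ≡ sumList ys (λ y → sumList xs (λ x → f x y))
sumList-comm []       ys f = sym (sumList-zero ys)
sumList-comm (x ∷ xs) ys f = trans (cong (sumList ys (f x) ℕ+_) (sumList-comm xs ys f))
  (sym (sumList-+ ys (f x) (λ y → sumList xs (λ x′ → f x′ y))))

letters : List Step
letters = U ∷ H ∷ D ∷ []

sumWords : ℕ → (List Step → ℕ) → ℕ
sumWords n = sumList (wordsOfLength n)

sumWords-cons : ∀ n f → sumWords (suc n) f ≡ sumWords n (λ w → sumList letters (λ x → f (x ∷ w)))
sumWords-cons n f = sumList-concatMap _ (wordsOfLength n) f

sumWords-snoc : ∀ n f → sumWords (suc n) f ≡ sumWords n (λ w → sumList letters (λ x → f (w ∷ʳ x)))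
sumWords-snoc zero    f = sym (ℕ.+-identityʳ _)
sumWords-snoc (suc n) f = begin
  sumWords (suc (suc n)) f
    ≡⟨ sumWords-cons (suc n) f ⟩
  sumWords (suc n) (λ w → sumList letters (λ x → f (x ∷ w)))
    ≡⟨ sumWords-snoc n _ ⟩
  sumWords n (λ w → sumList letters (λ y → sumList letters (λ x → f (x ∷ w ∷ʳ y))))
    ≡⟨ sumList-cong (wordsOfLength n) (λ w → sumList-comm letters letters (λ y x → f (x ∷ w ∷ʳ y))) ⟩
  sumWords n (λ w → sumList letters (λ x → sumList letters (λ y → f (x ∷ w ∷ʳ y))))
    ≡⟨ sumWords-cons n _ ⟨
  sumWords (suc n) (λ w → sumList letters (λ y → f (w ∷ʳ y))) ∎
  where open ≡-Reasoning

data State : Set where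
  dead : State
  at   : ℕ → Step → State

up : Step → ℕ → State
up U k = at (suc k) U
up H k = dead
up D k = at (suc k) U

flat : Step → ℕ → State
flat U k = at k H
flat H k = at k H
flat D k = dead

down : ℕ → State
down zero    = dead
down (suc k) = at k D

step : State → Step → State
step dead     _ = dead
step (at k X) U = up X k
step (at k X) H = flat X k
step (at k X) D = down k

-- The empty word is read as if it followed an up-step to level 0: a leading U creates
-- neither DH nor HU, and the empty word is then counted among the words ending with U.
run : List Step → State
run = foldl step (at 0 U)

endsAt : ℕ → State → Bool
endsAt j dead     = false
endsAt j (at k _) = k ≡ᵇ j

meanderFrom : ℤ → List Step → Bool
meanderFrom c w = allᵇ (λ p → + 0 ℤ.≤ᵇ c ℤ.+ height p) (prefixes w)

avoidsAfter : Step → List Step → Bool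
avoidsAfter X w = not (containsAdj D H (X ∷ w)) ∧ not (containsAdj H U (X ∷ w))

admissibleAt : ℤ → Step → List Step → ℕ → Bool
admissibleAt c X w j = meanderFrom c w ∧ (avoidsAfter X w ∧ eqℤ (c ℤ.+ level w) (+ j))

allᵇ-cong : ∀ {A : Set} {p q : A → Bool} xs → (∀ x → p x ≡ q x) → allᵇ p xs ≡ allᵇ q xs
allᵇ-cong []       p≗q = refl
allᵇ-cong (x ∷ xs) p≗q = cong₂ _∧_ (p≗q x) (allᵇ-cong xs p≗q)

allᵇ-map : ∀ {A B : Set} (p : B → Bool) (f : A → B) xs → allᵇ p (map f xs) ≡ allᵇ (λ x → p (f x)) xs
allᵇ-map p f []       = refl
allᵇ-map p f (x ∷ xs) = cong (p (f x) ∧_) (allᵇ-map p f xs)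

meanderFrom-∷ : ∀ c y w
  → meanderFrom c (y ∷ w) ≡ (+ 0 ℤ.≤ᵇ c ℤ.+ + 0) ∧ meanderFrom (c ℤ.+ stepHeight y) w
meanderFrom-∷ c y w = cong ((+ 0 ℤ.≤ᵇ c ℤ.+ + 0) ∧_)
  (trans (allᵇ-map (λ p → + 0 ℤ.≤ᵇ c ℤ.+ height p) (y ∷_) (prefixes w))
    (allᵇ-cong (prefixes w) (λ p → cong (+ 0 ℤ.≤ᵇ_) (sym (ℤ.+-assoc c (stepHeight y) (height p))))))

meanderFrom-negative : ∀ w → meanderFrom -[1+ 0 ] w ≡ false
meanderFrom-negative []      = refl
meanderFrom-negative (_ ∷ _) = refl

eqℤ-+ : ∀ k j → eqℤ (+ k) (+ j) ≡ (k ≡ᵇ j)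
eqℤ-+ zero    zero    = refl
eqℤ-+ zero    (suc j) = refl
eqℤ-+ (suc k) zero    = refl
eqℤ-+ (suc k) (suc j) = trans (cong₂ _∧_ (<ᵇ-suc k j) (<ᵇ-suc j k)) (eqℤ-+ k j)
  where
  <ᵇ-suc : ∀ m n → (m ℕ.<ᵇ suc n) ≡ (m ℕ.≤ᵇ n)
  <ᵇ-suc zero    n = refl
  <ᵇ-suc (suc m) n = refl

avoidsAfter-U : ∀ w → avoidsAfter U w ≡ not (containsAdj D H w) ∧ not (containsAdj H U w)
avoidsAfter-U []      = refl
avoidsAfter-U (_ ∷ _) = refl

avoidsAfter-D : ∀ X w → avoidsAfter X (D ∷ w) ≡ avoidsAfter D w
avoidsAfter-D U w = refl
avoidsAfter-D H w = refl
avoidsAfter-D D w = refl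

admissibleAt-∷ : ∀ k X y w j → avoidsAfter X (y ∷ w) ≡ avoidsAfter y w
  → admissibleAt (+ k) X (y ∷ w) j ≡ admissibleAt (+ k ℤ.+ stepHeight y) y w j
admissibleAt-∷ k X y w j allowed = cong₂ (λ m (ae : Bool × ℤ) → m ∧ (proj₁ ae ∧ eqℤ (proj₂ ae) (+ j)))
  (meanderFrom-∷ (+ k) y w) (cong₂ _,_ allowed (sym (ℤ.+-assoc (+ k) (stepHeight y) (level w))))

admissibleAt-forbidden : ∀ c X y w j → avoidsAfter X (y ∷ w) ≡ false → admissibleAt c X (y ∷ w) j ≡ false
admissibleAt-forbidden c X y w j forbidden =
  trans (cong (λ a → meanderFrom c (y ∷ w) ∧ (a ∧ eqℤ (c ℤ.+ level (y ∷ w)) (+ j))) forbidden)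
    (Bool.∧-zeroʳ (meanderFrom c (y ∷ w)))

admissibleAt-negative : ∀ X w j → admissibleAt -[1+ 0 ] X w j ≡ false
admissibleAt-negative X w j =
  cong (_∧ (avoidsAfter X w ∧ eqℤ (-[1+ 0 ] ℤ.+ level w) (+ j))) (meanderFrom-negative w)

foldl-dead : ∀ w → foldl step dead w ≡ dead
foldl-dead []      = refl
foldl-dead (_ ∷ w) = foldl-dead w

rejected : ∀ {b} w j → b ≡ false → b ≡ endsAt j (foldl step dead w)
rejected w j b≡false = trans b≡false (cong (endsAt j) (sym (foldl-dead w)))

admissibleAt-run : ∀ w k X j → admissibleAt (+ k) X w j ≡ endsAt j (foldl step (at k X) w)
admissibleAt-run []      k X j = trans (cong (λ i → eqℤ (+ i) (+ j)) (ℕ.+-identityʳ k)) (eqℤ-+ k j)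
admissibleAt-run (U ∷ w) k U j = trans (admissibleAt-∷ k U U w j refl)
  (trans (cong (λ i → admissibleAt (+ i) U w j) (ℕ.+-comm k 1)) (admissibleAt-run w (suc k) U j))
admissibleAt-run (U ∷ w) k D j = trans (admissibleAt-∷ k D U w j refl)
  (trans (cong (λ i → admissibleAt (+ i) U w j) (ℕ.+-comm k 1)) (admissibleAt-run w (suc k) U j))
admissibleAt-run (U ∷ w) k H j = rejected w j (admissibleAt-forbidden (+ k) H U w j
  (Bool.∧-zeroʳ (not (containsAdj D H (U ∷ w)))))
admissibleAt-run (H ∷ w) k U j = trans (admissibleAt-∷ k U H w j refl)
  (trans (cong (λ i → admissibleAt (+ i) H w j) (ℕ.+-identityʳ k)) (admissibleAt-run w k H j))
admissibleAt-run (H ∷ w) k H j = trans (admissibleAt-∷ k H H w j refl)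
  (trans (cong (λ i → admissibleAt (+ i) H w j) (ℕ.+-identityʳ k)) (admissibleAt-run w k H j))
admissibleAt-run (H ∷ w) k D j = rejected w j (admissibleAt-forbidden (+ k) D H w j refl)
admissibleAt-run (D ∷ w) zero X j = rejected w j
  (trans (admissibleAt-∷ 0 X D w j (avoidsAfter-D X w)) (admissibleAt-negative D w j))
admissibleAt-run (D ∷ w) (suc k) X j =
  trans (admissibleAt-∷ (suc k) X D w j (avoidsAfter-D X w)) (admissibleAt-run w k D j)

inM-run : ∀ w j → (inM w ∧ eqℤ (level w) (+ j)) ≡ endsAt j (run w)
inM-run w j = begin
  (isMeander w ∧ (not (containsAdj D H w) ∧ not (containsAdj H U w))) ∧ eqℤ (level w) (+ j)
    ≡⟨ Bool.∧-assoc (isMeander w) _ _ ⟩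
  isMeander w ∧ ((not (containsAdj D H w) ∧ not (containsAdj H U w)) ∧ eqℤ (level w) (+ j))
    ≡⟨ cong₂ (λ m a → m ∧ (a ∧ eqℤ (level w) (+ j)))
         (allᵇ-cong (prefixes w) (λ p → cong (+ 0 ℤ.≤ᵇ_) (sym (ℤ.+-identityˡ (height p)))))
         (sym (avoidsAfter-U w)) ⟩
  meanderFrom (+ 0) w ∧ (avoidsAfter U w ∧ eqℤ (level w) (+ j))
    ≡⟨ cong (λ l → meanderFrom (+ 0) w ∧ (avoidsAfter U w ∧ eqℤ l (+ j)))
         (sym (ℤ.+-identityˡ (level w))) ⟩
  admissibleAt (+ 0) U w j
    ≡⟨ admissibleAt-run w 0 U j ⟩
  endsAt j (run w) ∎
  where open ≡-Reasoning

boolToℕ : Bool → ℕ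
boolToℕ true  = 1
boolToℕ false = 0

length-filterᵇ : ∀ {A : Set} (p : A → Bool) xs → length (filterᵇ p xs) ≡ sumList xs (λ x → boolToℕ (p x))
length-filterᵇ p []       = refl
length-filterᵇ p (x ∷ xs) with p x
... | true  = cong suc (length-filterᵇ p xs)
... | false = length-filterᵇ p xs

endsWith : Step → ℕ → State → ℕ
endsWith X j dead     = 0
endsWith X j (at k Y) = boolToℕ ((X == Y) ∧ (k ≡ᵇ j))

endsAt-split : ∀ j σ → boolToℕ (endsAt j σ) ≡ endsWith U j σ ℕ+ endsWith H j σ ℕ+ endsWith D j σ
endsAt-split j dead     = refl
endsAt-split j (at k U) = sym (trans (ℕ.+-identityʳ _) (ℕ.+-identityʳ _))
endsAt-split j (at k H) = sym (ℕ.+-identityʳ _)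
endsAt-split j (at k D) = refl

countEnding : Step → ℕ → ℕ → ℕ
countEnding X n j = sumWords n (λ w → endsWith X j (run w))

countM-split : ∀ n j → countM n j ≡ countEnding U n j ℕ+ countEnding H n j ℕ+ countEnding D n j
countM-split n j = begin
  countM n j
    ≡⟨ length-filterᵇ (λ w → inM w ∧ eqℤ (level w) (+ j)) (wordsOfLength n) ⟩
  sumWords n (λ w → boolToℕ (inM w ∧ eqℤ (level w) (+ j)))
    ≡⟨ sumList-cong (wordsOfLength n) (λ w → trans (cong boolToℕ (inM-run w j)) (endsAt-split j (run w))) ⟩
  sumWords n (λ w → endsWith U j (run w) ℕ+ endsWith H j (run w) ℕ+ endsWith D j (run w))
    ≡⟨ sumList-+ (wordsOfLength n) _ (λ w → endsWith D j (run w)) ⟩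
  sumWords n (λ w → endsWith U j (run w) ℕ+ endsWith H j (run w)) ℕ+ countEnding D n j
    ≡⟨ cong (_ℕ+ countEnding D n j)
         (sumList-+ (wordsOfLength n) (λ w → endsWith U j (run w)) (λ w → endsWith H j (run w))) ⟩
  countEnding U n j ℕ+ countEnding H n j ℕ+ countEnding D n j ∎
  where open ≡-Reasoning

sumWords-run : ∀ n (f g : State → ℕ) → (∀ σ → sumList letters (λ x → f (step σ x)) ≡ g σ)
  → sumWords (suc n) (λ w → f (run w)) ≡ sumWords n (λ w → g (run w))
sumWords-run n f g incoming = trans (sumWords-snoc n (λ w → f (run w)))
  (sumList-cong (wordsOfLength n) (λ w →
    trans (sumList-cong letters (λ x → cong f (List.foldl-++ step (at 0 U) w (x ∷ [])))) (incoming (run w))))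

into-U-zero : ∀ σ → sumList letters (λ x → endsWith U 0 (step σ x)) ≡ 0
into-U-zero dead           = refl
into-U-zero (at zero U)    = refl
into-U-zero (at (suc k) U) = refl
into-U-zero (at zero H)    = refl
into-U-zero (at (suc k) H) = refl
into-U-zero (at zero D)    = refl
into-U-zero (at (suc k) D) = refl

into-U : ∀ j σ → sumList letters (λ x → endsWith U (suc j) (step σ x)) ≡ endsWith U j σ ℕ+ endsWith D j σ
into-U j dead           = refl
into-U j (at zero U)    = refl
into-U j (at (suc k) U) = refl
into-U j (at zero H)    = refl
into-U j (at (suc k) H) = refl
into-U j (at zero D)    = ℕ.+-identityʳ _
into-U j (at (suc k) D) = ℕ.+-identityʳ _

into-H : ∀ j σ → sumList letters (λ x → endsWith H j (step σ x)) ≡ endsWith U j σ ℕ+ endsWith H j σ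
into-H j dead           = refl
into-H j (at zero U)    = refl
into-H j (at (suc k) U) = refl
into-H j (at zero H)    = ℕ.+-identityʳ _
into-H j (at (suc k) H) = ℕ.+-identityʳ _
into-H j (at zero D)    = refl
into-H j (at (suc k) D) = refl

into-D : ∀ j σ → sumList letters (λ x → endsWith D j (step σ x))
  ≡ endsWith U (suc j) σ ℕ+ endsWith H (suc j) σ ℕ+ endsWith D (suc j) σ
into-D j dead           = refl
into-D j (at zero U)    = refl
into-D j (at (suc k) U) = sym (ℕ.+-identityʳ _)
into-D j (at zero H)    = refl
into-D j (at (suc k) H) = refl
into-D j (at zero D)    = refl
into-D j (at (suc k) D) = ℕ.+-identityʳ _

countEnding-U-zero : ∀ n → countEnding U (suc n) 0 ≡ 0
countEnding-U-zero n =
  trans (sumWords-run n (endsWith U 0) (λ _ → 0) into-U-zero) (sumList-zero (wordsOfLength n))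

countEnding-U-suc : ∀ n j → countEnding U (suc n) (suc j) ≡ countEnding U n j ℕ+ countEnding D n j
countEnding-U-suc n j = trans (sumWords-run n (endsWith U (suc j)) _ (into-U j))
  (sumList-+ (wordsOfLength n) (λ w → endsWith U j (run w)) (λ w → endsWith D j (run w)))

countEnding-H-suc : ∀ n j → countEnding H (suc n) j ≡ countEnding U n j ℕ+ countEnding H n j
countEnding-H-suc n j = trans (sumWords-run n (endsWith H j) _ (into-H j))
  (sumList-+ (wordsOfLength n) (λ w → endsWith U j (run w)) (λ w → endsWith H j (run w)))

countEnding-D-suc : ∀ n j → countEnding D (suc n) j
  ≡ countEnding U n (suc j) ℕ+ countEnding H n (suc j) ℕ+ countEnding D n (suc j)
countEnding-D-suc n j = trans (sumWords-run n (endsWith D j) _ (into-D j))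
  (trans (sumList-+ (wordsOfLength n) _ (λ w → endsWith D (suc j) (run w)))
    (cong (_ℕ+ countEnding D n (suc j))
      (sumList-+ (wordsOfLength n) (λ w → endsWith U (suc j) (run w)) (λ w → endsWith H (suc j) (run w)))))

ℚof-+ : ∀ a b → ℚof (a ℕ+ b) ≡ ℚof a ℚ.+ ℚof b
ℚof-+ a b = sym (begin
  ℚof a ℚ.+ ℚof b                             ≡⟨ cong₂ ℚ._+_ (ℚof≡mkℚ a) (ℚof≡mkℚ b) ⟩
  ℚ.mkℚ (+ a) 0 (coprime a) ℚ.+ ℚ.mkℚ (+ b) 0 (coprime b)
    ≡⟨ cong (ℚ._/ 1) (cong₂ ℤ._+_ (ℤ.*-identityʳ (+ a)) (ℤ.*-identityʳ (+ b))) ⟩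
  ℚof (a ℕ+ b)                                ∎)
  where
  open ≡-Reasoning
  coprime : ∀ a → Coprimality.Coprime a 1
  coprime a = Coprimality.sym (Coprimality.1-coprimeTo a)
  ℚof≡mkℚ : ∀ a → ℚof a ≡ ℚ.mkℚ (+ a) 0 (coprime a)
  ℚof≡mkℚ a = ℚ.normalize-coprime (coprime a)

ℚof-+₃ : ∀ a b c → ℚof (a ℕ+ b ℕ+ c) ≡ ℚof a ℚ.+ ℚof b ℚ.+ ℚof c
ℚof-+₃ a b c = trans (ℚof-+ (a ℕ+ b) c) (cong (ℚ._+ ℚof c) (ℚof-+ a b))

countSeries : Step → ℕ → PS
countSeries X j n = ℚof (countEnding X n j)

counts-system : LastLetterSystem (countSeries U) (countSeries H) (countSeries D)
counts-system = record
  { u-zero = λ { zero → refl ; (suc n) → cong ℚof (countEnding-U-zero n) }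
  ; u-suc  = λ j → ≈zₚ-*ₚ refl (λ n → trans (cong ℚof (countEnding-U-suc n j))
      (ℚof-+ (countEnding U n j) (countEnding D n j)))
  ; h-rec  = λ j → ≈zₚ-*ₚ refl (λ n → trans (cong ℚof (countEnding-H-suc n j))
      (ℚof-+ (countEnding U n j) (countEnding H n j)))
  ; d-rec  = λ j → ≈zₚ-*ₚ refl (λ n → trans (cong ℚof (countEnding-D-suc n j))
      (ℚof-+₃ (countEnding U n (suc j)) (countEnding H n (suc j)) (countEnding D n (suc j))))
  }

-- The power-series root of the kernel

kernel shiftedKernel : PS → PS
kernel x =
  zₚ *ₚ (oneₚ -ₚ zₚ) *ₚ (x *ₚ x) -ₚ (oneₚ -ₚ zₚ -ₚ zₚ ^ 3) *ₚ x +ₚ zₚ *ₚ (oneₚ -ₚ zₚ)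
shiftedKernel y =
  zₚ *ₚ (oneₚ -ₚ zₚ) *ₚ zₚ *ₚ (y *ₚ y) -ₚ (oneₚ -ₚ zₚ -ₚ zₚ ^ 3) *ₚ y +ₚ (oneₚ -ₚ zₚ)

kernel-cong : ∀ {x y} → x ≈ₚ y → kernel x ≈ₚ kernel y
kernel-cong x≈y = PS.+-cong
  (-ₚ-cong (*ₚ-cong (PS.refl {zₚ *ₚ (oneₚ -ₚ zₚ)}) (*ₚ-cong x≈y x≈y))
           (*ₚ-cong (PS.refl {oneₚ -ₚ zₚ -ₚ zₚ ^ 3}) x≈y))
  (PS.refl {zₚ *ₚ (oneₚ -ₚ zₚ)})

kernel-zₚ-* : ∀ y → kernel (zₚ *ₚ y) ≈ₚ zₚ *ₚ shiftedKernel y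
kernel-zₚ-* y = solve 2 (λ z y →
    let k₁ = z :* (con 1ℚ :- z) :* z :* (y :* y) :- (con 1ℚ :- z :- z :^ 3) :* y :+ (con 1ℚ :- z)
    in z :* (con 1ℚ :- z) :* ((z :* y) :* (z :* y)) :- (con 1ℚ :- z :- z :^ 3) :* (z :* y)
         :+ z :* (con 1ℚ :- z) := z :* k₁)
  PS.refl zₚ y
  where open PS-Solver

-- Since (1-z-z³)² - radicand = 4z²(1-z)², the equation for r₁ turns W² - radicand into
-- 4z(1-z)·kernel r₁.
kernel-root : ∀ W r → W *ₚ W ≈ₚ radicand
  → (const (ℚof 2) *ₚ zₚ *ₚ (oneₚ -ₚ zₚ)) *ₚ r ≈ₚ oneₚ -ₚ zₚ -ₚ zₚ ^ₚ 3 -ₚ W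
  → kernel r ≈ₚ 0ₚ
kernel-root W r W²≈radicand r-def =
  *ₚ-cancelˡ-invertible {u = oneₚ -ₚ zₚ} {v = invOneMinusZ} invOneMinusZ-inverse
    (zₚ-*ₚ-cancelˡ
      (*ₚ-cancelˡ-invertible {u = const (ℚof 4)} {v = const (+ 1 ℚ./ 4)}
        (solve 0 (con (+ 1 ℚ./ 4) :* con (ℚof 4) := con 1ℚ) PS.refl)
        scaled))
  where
  open PS-Solver
  open ≈-Reasoning
  a b : PS
  a = oneₚ -ₚ zₚ -ₚ zₚ ^ 3
  b = const (ℚof 2) *ₚ zₚ *ₚ (oneₚ -ₚ zₚ)
  W≈a-br : W ≈ₚ a -ₚ b *ₚ r
  W≈a-br = begin
    W
      ≈⟨ solve 2 (λ a w → w := a :- (a :- w)) PS.refl a W ⟩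
    a -ₚ (a -ₚ W)
      ≈⟨ -ₚ-cong (PS.refl {a})
           (-ₚ-cong (-ₚ-cong (PS.refl {oneₚ -ₚ zₚ}) (^ₚ≈^ zₚ 3)) (PS.refl {W})) ⟨
    a -ₚ (oneₚ -ₚ zₚ -ₚ zₚ ^ₚ 3 -ₚ W)
      ≈⟨ -ₚ-cong (PS.refl {a}) r-def ⟨
    a -ₚ b *ₚ r ∎
  radicand′ : PS
  radicand′ = (oneₚ -ₚ const (ℚof 3) *ₚ zₚ +ₚ const (ℚof 2) *ₚ zₚ ^ 2 -ₚ zₚ ^ 3)
           *ₚ (oneₚ +ₚ zₚ -ₚ const (ℚof 2) *ₚ zₚ ^ 2 -ₚ zₚ ^ 3)
  radicand≈ : radicand ≈ₚ radicand′
  radicand≈ = *ₚ-cong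
    (-ₚ-cong (PS.+-cong (PS.refl {oneₚ -ₚ const (ℚof 3) *ₚ zₚ}) 2z²) (^ₚ≈^ zₚ 3))
    (-ₚ-cong (-ₚ-cong (PS.refl {oneₚ +ₚ zₚ}) 2z²) (^ₚ≈^ zₚ 3))
    where
    2z² : const (ℚof 2) *ₚ zₚ ^ₚ 2 ≈ₚ const (ℚof 2) *ₚ zₚ ^ 2
    2z² = *ₚ-cong (PS.refl {const (ℚof 2)}) (^ₚ≈^ zₚ 2)
  scaled : const (ℚof 4) *ₚ (zₚ *ₚ ((oneₚ -ₚ zₚ) *ₚ kernel r))
         ≈ₚ const (ℚof 4) *ₚ (zₚ *ₚ ((oneₚ -ₚ zₚ) *ₚ 0ₚ))
  scaled = begin
    const (ℚof 4) *ₚ (zₚ *ₚ ((oneₚ -ₚ zₚ) *ₚ kernel r))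
      ≈⟨ solve 2 (λ z x →
           let a = con 1ℚ :- z :- z :^ 3
               b = con (ℚof 2) :* z :* (con 1ℚ :- z)
           in con (ℚof 4) :* (z :* ((con 1ℚ :- z) :*
                (z :* (con 1ℚ :- z) :* (x :* x) :- a :* x :+ z :* (con 1ℚ :- z))))
              := (a :- b :* x) :* (a :- b :* x)
                 :- (con 1ℚ :- con (ℚof 3) :* z :+ con (ℚof 2) :* z :^ 2 :- z :^ 3)
                    :* (con 1ℚ :+ z :- con (ℚof 2) :* z :^ 2 :- z :^ 3))
           PS.refl zₚ r ⟩
    (a -ₚ b *ₚ r) *ₚ (a -ₚ b *ₚ r) -ₚ radicand′
      ≈⟨ -ₚ-cong (*ₚ-cong W≈a-br W≈a-br) radicand≈ ⟨
    W *ₚ W -ₚ radicand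
      ≈⟨ -ₚ-cong W²≈radicand (PS.refl {radicand}) ⟩
    radicand -ₚ radicand
      ≈⟨ PS.-‿inverseʳ radicand ⟩
    0ₚ
      ≈⟨ PS.zeroʳ (const (ℚof 4)) ⟨
    const (ℚof 4) *ₚ 0ₚ
      ≈⟨ *ₚ-cong (PS.refl {const (ℚof 4)}) (PS.zeroʳ zₚ) ⟨
    const (ℚof 4) *ₚ (zₚ *ₚ 0ₚ)
      ≈⟨ *ₚ-cong (PS.refl {const (ℚof 4)}) (*ₚ-cong (PS.refl {zₚ}) (PS.zeroʳ (oneₚ -ₚ zₚ))) ⟨
    const (ℚof 4) *ₚ (zₚ *ₚ ((oneₚ -ₚ zₚ) *ₚ 0ₚ)) ∎

module KernelRoot (r : PS) (r-root : kernel r ≈ₚ 0ₚ) where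

  r-zero : r 0 ≡ 0ℚ
  r-zero = ℚ.neg-injective (trans (sym kernel-at-0) (r-root 0))
    where
    open +-*-Solver
    kernel-at-0 : kernel r 0 ≡ ℚ.- r 0
    kernel-at-0 = solve 1 (λ x → con 0ℚ :* (x :* x) :- con 1ℚ :* x :+ con 0ℚ := :- x) refl (r 0)

  s : PS
  s = divZ r

  zs≈r : zₚ *ₚ s ≈ₚ r
  zs≈r = PS.sym (≈zₚ-*ₚ r-zero (λ _ → refl))

  s-root : shiftedKernel s ≈ₚ 0ₚ
  s-root = zₚ-*ₚ-cancelˡ (begin
    zₚ *ₚ shiftedKernel s   ≈⟨ kernel-zₚ-* s ⟨
    kernel (zₚ *ₚ s)        ≈⟨ kernel-cong zs≈r ⟩
    kernel r                ≈⟨ r-root ⟩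
    0ₚ                      ≈⟨ PS.zeroʳ zₚ ⟨
    zₚ *ₚ 0ₚ                ∎)
    where open ≈-Reasoning

  s-zero : s 0 ≡ 1ℚ
  s-zero = sym (x∙y⁻¹≈ε⇒x≈y 1ℚ (s 0) (trans (sym s-root-at-0) (s-root 0)))
    where
    open +-*-Solver
    s-root-at-0 : shiftedKernel s 0 ≡ 1ℚ ℚ.- s 0
    s-root-at-0 = solve 1 (λ y → con 0ℚ :* (y :* y) :- con 1ℚ :* y :+ con 1ℚ := con 1ℚ :- y) refl (s 0)

  G : PS
  G = zₚ *ₚ invOneMinusZ

  s-1≈ : s -ₚ oneₚ ≈ₚ zₚ *ₚ zₚ *ₚ s *ₚ (s +ₚ G)
  s-1≈ = *ₚ-cancelˡ-invertible {u = oneₚ -ₚ zₚ} {v = invOneMinusZ} invOneMinusZ-inverse (begin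
    (oneₚ -ₚ zₚ) *ₚ (s -ₚ oneₚ)
      ≈⟨ PS.+-identityʳ _ ⟨
    (oneₚ -ₚ zₚ) *ₚ (s -ₚ oneₚ) +ₚ 0ₚ
      ≈⟨ PS.+-cong (PS.refl {(oneₚ -ₚ zₚ) *ₚ (s -ₚ oneₚ)}) s-root ⟨
    (oneₚ -ₚ zₚ) *ₚ (s -ₚ oneₚ) +ₚ shiftedKernel s
      ≈⟨ solve 2 (λ z y → (con 1ℚ :- z) :* (y :- con 1ℚ)
                    :+ (z :* (con 1ℚ :- z) :* z :* (y :* y) :- (con 1ℚ :- z :- z :^ 3) :* y :+ (con 1ℚ :- z))
                  := z :* z :* (con 1ℚ :- z) :* (y :* y) :+ z :^ 3 :* y :* con 1ℚ)
           PS.refl zₚ s ⟩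
    zₚ *ₚ zₚ *ₚ (oneₚ -ₚ zₚ) *ₚ (s *ₚ s) +ₚ zₚ ^ 3 *ₚ s *ₚ oneₚ
      ≈⟨ PS.+-cong (PS.refl {zₚ *ₚ zₚ *ₚ (oneₚ -ₚ zₚ) *ₚ (s *ₚ s)})
           (*ₚ-cong (PS.refl {zₚ ^ 3 *ₚ s}) invOneMinusZ-inverse) ⟨
    zₚ *ₚ zₚ *ₚ (oneₚ -ₚ zₚ) *ₚ (s *ₚ s)
      +ₚ zₚ ^ 3 *ₚ s *ₚ (invOneMinusZ *ₚ (oneₚ -ₚ zₚ))
      ≈⟨ solve 3 (λ z y i → z :* z :* (con 1ℚ :- z) :* (y :* y)
                            :+ z :^ 3 :* y :* (i :* (con 1ℚ :- z))
                  := (con 1ℚ :- z) :* (z :* z :* y :* (y :+ z :* i)))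
           PS.refl zₚ s invOneMinusZ ⟩
    (oneₚ -ₚ zₚ) *ₚ (zₚ *ₚ zₚ *ₚ s *ₚ (s +ₚ G)) ∎)
    where
    open PS-Solver
    open ≈-Reasoning

  uSeries hSeries dSeries : ℕ → PS
  uSeries j = r ^ₚ j
  hSeries j = G *ₚ r ^ₚ j
  dSeries j = (s -ₚ oneₚ) *ₚ r ^ₚ j

  series-system : LastLetterSystem uSeries hSeries dSeries
  series-system = record { u-zero = ^ₚ≈^ r 0 ; u-suc = u-suc ; h-rec = h-rec ; d-rec = d-rec }
    where
    open PS-Solver
    open ≈-Reasoning
    u-suc : ∀ j → r ^ₚ suc j ≈ₚ zₚ *ₚ (r ^ₚ j +ₚ dSeries j)
    u-suc j = begin
      r *ₚ r ^ₚ j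
        ≈⟨ *ₚ-cong zs≈r (PS.refl {r ^ₚ j}) ⟨
      zₚ *ₚ s *ₚ r ^ₚ j
        ≈⟨ solve 3 (λ z y x → z :* y :* x := z :* (x :+ (y :- con 1ℚ) :* x)) PS.refl zₚ s (r ^ₚ j) ⟩
      zₚ *ₚ (r ^ₚ j +ₚ dSeries j) ∎
    h-rec : ∀ j → hSeries j ≈ₚ zₚ *ₚ (r ^ₚ j +ₚ hSeries j)
    h-rec j = begin
      zₚ *ₚ invOneMinusZ *ₚ r ^ₚ j
        ≈⟨ *ₚ-cong (*ₚ-cong (PS.refl {zₚ}) invOneMinusZ-unfold) (PS.refl {r ^ₚ j}) ⟩
      zₚ *ₚ (oneₚ +ₚ zₚ *ₚ invOneMinusZ) *ₚ r ^ₚ j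
        ≈⟨ solve 3 (λ z i x → z :* (con 1ℚ :+ z :* i) :* x := z :* (x :+ z :* i :* x))
             PS.refl zₚ invOneMinusZ (r ^ₚ j) ⟩
      zₚ *ₚ (r ^ₚ j +ₚ hSeries j) ∎
    d-rec : ∀ j → dSeries j ≈ₚ zₚ *ₚ (r ^ₚ suc j +ₚ hSeries (suc j) +ₚ dSeries (suc j))
    d-rec j = begin
      (s -ₚ oneₚ) *ₚ r ^ₚ j
        ≈⟨ *ₚ-cong s-1≈ (PS.refl {r ^ₚ j}) ⟩
      zₚ *ₚ zₚ *ₚ s *ₚ (s +ₚ G) *ₚ r ^ₚ j
        ≈⟨ solve 4 (λ z y g x → z :* z :* y :* (y :+ g) :* x := z :* (z :* y :* x :* (y :+ g)))
             PS.refl zₚ s G (r ^ₚ j) ⟩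
      zₚ *ₚ (zₚ *ₚ s *ₚ r ^ₚ j *ₚ (s +ₚ G))
        ≈⟨ *ₚ-cong (PS.refl {zₚ}) (*ₚ-cong (*ₚ-cong zs≈r (PS.refl {r ^ₚ j})) (PS.refl {s +ₚ G})) ⟩
      zₚ *ₚ (r ^ₚ suc j *ₚ (s +ₚ G))
        ≈⟨ solve 4 (λ z x y g → z :* (x :* (y :+ g)) := z :* (x :+ g :* x :+ (y :- con 1ℚ) :* x))
             PS.refl zₚ (r ^ₚ suc j) s G ⟩
      zₚ *ₚ (r ^ₚ suc j +ₚ hSeries (suc j) +ₚ dSeries (suc j)) ∎

  closedForm : ℕ → PS
  closedForm j = (s +ₚ G) *ₚ r ^ₚ j

  series-sum : ∀ j → uSeries j +ₚ hSeries j +ₚ dSeries j ≈ₚ closedForm j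
  series-sum j =
    solve 3 (λ x g y → x :+ g :* x :+ (y :- con 1ℚ) :* x := (y :+ g) :* x) PS.refl (r ^ₚ j) G s
    where open PS-Solver

  closedForm-expand : ∀ j → closedForm j ≈ₚ divZ (r ^ₚ suc j) +ₚ (zₚ *ₚ r ^ₚ j) *ₚ invOneMinusZ
  closedForm-expand j = begin
    (s +ₚ G) *ₚ r ^ₚ j
      ≈⟨ solve 4 (λ y z i x → (y :+ z :* i) :* x := y :* x :+ (z :* x) :* i)
           PS.refl s zₚ invOneMinusZ (r ^ₚ j) ⟩
    s *ₚ r ^ₚ j +ₚ (zₚ *ₚ r ^ₚ j) *ₚ invOneMinusZ
      ≈⟨ PS.+-cong (divZ-*ₚ {r} (r ^ₚ j) r-zero) (PS.refl {(zₚ *ₚ r ^ₚ j) *ₚ invOneMinusZ}) ⟨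
    divZ (r ^ₚ suc j) +ₚ (zₚ *ₚ r ^ₚ j) *ₚ invOneMinusZ ∎
    where
    open PS-Solver
    open ≈-Reasoning

  linearInU-*₂-columns : ∀ F → (∀ j → column F j ≈ₚ closedForm j)
    → linearInU (zₚ *ₚ (oneₚ -ₚ zₚ)) r *₂ F ≈₂ lift ((oneₚ -ₚ zₚ) *ₚ r +ₚ zₚ ^ₚ 2)
  linearInU-*₂-columns F F≈ n j = columns j n
    where
    open PS-Solver
    open ≈-Reasoning
    p : PS
    p = zₚ *ₚ (oneₚ -ₚ zₚ)
    columns : ∀ j → column (linearInU p r *₂ F) j ≈ₚ column (lift ((oneₚ -ₚ zₚ) *ₚ r +ₚ zₚ ^ₚ 2)) j
    columns zero = begin
      column (linearInU p r) 0 *ₚ column F 0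
        ≈⟨ *ₚ-cong (linearInU-column-0 p r) (PS.trans (F≈ 0) (*ₚ-cong (PS.refl {s +ₚ G}) (^ₚ≈^ r 0))) ⟩
      p *ₚ ((s +ₚ G) *ₚ oneₚ)
        ≈⟨ solve 3 (λ z y i → z :* (con 1ℚ :- z) :* ((y :+ z :* i) :* con 1ℚ)
                    := (con 1ℚ :- z) :* (z :* y) :+ z :^ 2 :* (i :* (con 1ℚ :- z)))
             PS.refl zₚ s invOneMinusZ ⟩
      (oneₚ -ₚ zₚ) *ₚ (zₚ *ₚ s) +ₚ zₚ ^ 2 *ₚ (invOneMinusZ *ₚ (oneₚ -ₚ zₚ))
        ≈⟨ PS.+-cong (*ₚ-cong (PS.refl {oneₚ -ₚ zₚ}) zs≈r)
             (*ₚ-cong (PS.sym (^ₚ≈^ zₚ 2)) invOneMinusZ-inverse) ⟩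
      (oneₚ -ₚ zₚ) *ₚ r +ₚ zₚ ^ₚ 2 *ₚ oneₚ
        ≈⟨ PS.+-cong (PS.refl {(oneₚ -ₚ zₚ) *ₚ r}) (*ₚ-identityʳ (zₚ ^ₚ 2)) ⟩
      (oneₚ -ₚ zₚ) *ₚ r +ₚ zₚ ^ₚ 2 ∎
    columns (suc k) = begin
      column (linearInU p r *₂ F) (suc k)
        ≈⟨ column-*₂-suc (linearInU p r) F (linearInU-degree≤1 p r) k ⟩
      column (linearInU p r) 0 *ₚ column F (suc k) +ₚ column (linearInU p r) 1 *ₚ column F k
        ≈⟨ PS.+-cong (*ₚ-cong (linearInU-column-0 p r) (F≈ (suc k)))
             (*ₚ-cong (linearInU-column-1 p r) (F≈ k)) ⟩
      p *ₚ ((s +ₚ G) *ₚ (r *ₚ r ^ₚ k)) +ₚ p *ₚ (-ₚ r) *ₚ ((s +ₚ G) *ₚ r ^ₚ k)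
        ≈⟨ solve 4 (λ p t r x → p :* (t :* (r :* x)) :+ p :* (:- r) :* (t :* x) := con 0ℚ)
             PS.refl p (s +ₚ G) r (r ^ₚ k) ⟩
      const 0ℚ
        ≈⟨ (λ { zero → refl ; (suc _) → refl }) ⟩
      0ₚ ∎

mainTheorem9 : (W r₁ : PS)
    → W 0 ≡ 1ℚ
    → (W *ₚ W) ≈ₚ radicand
    → ((const (ℚof 2) *ₚ zₚ *ₚ (oneₚ -ₚ zₚ)) *ₚ r₁) ≈ₚ (oneₚ -ₚ zₚ -ₚ (zₚ ^ₚ 3) -ₚ W)
    → ((lift (zₚ *ₚ (oneₚ -ₚ zₚ)) *₂ (lift oneₚ -₂ (uₚ *₂ lift r₁))) *₂ Sgf)
        ≈₂ lift (((oneₚ -ₚ zₚ) *ₚ r₁) +ₚ (zₚ ^ₚ 2))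
      × (∀ (j : ℕ) → Scoeff j ≈ₚ (divZ (r₁ ^ₚ suc j) +ₚ ((zₚ *ₚ (r₁ ^ₚ j)) *ₚ invOneMinusZ)))
mainTheorem9 W r₁ _ W²≈radicand r₁-def =
  linearInU-*₂-columns Sgf Sgf-columns , λ j → PS.trans (Sgf-columns j) (closedForm-expand j)
  where
  open KernelRoot r₁ (kernel-root W r₁ W²≈radicand r₁-def)
  Sgf-columns : ∀ j → column Sgf j ≈ₚ closedForm j
  Sgf-columns j n = begin
    ℚof (countM n j)
      ≡⟨ cong ℚof (countM-split n j) ⟩
    ℚof (countEnding U n j ℕ+ countEnding H n j ℕ+ countEnding D n j)
      ≡⟨ ℚof-+₃ (countEnding U n j) (countEnding H n j) (countEnding D n j) ⟩
    countSeries U j n ℚ.+ countSeries H j n ℚ.+ countSeries D j n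
      ≡⟨ cong₂ ℚ._+_ (cong₂ ℚ._+_ (proj₁ agree) (proj₁ (proj₂ agree))) (proj₂ (proj₂ agree)) ⟩
    uSeries j n ℚ.+ hSeries j n ℚ.+ dSeries j n
      ≡⟨ series-sum j n ⟩
    closedForm j n ∎
    where
    open ≡-Reasoning
    agree : countSeries U j n ≡ uSeries j n × countSeries H j n ≡ hSeries j n
          × countSeries D j n ≡ dSeries j n
    agree = LastLetterSystem-unique counts-system series-system n j
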